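{- Let $\bar a,\bar b\in\mathbb{R}^f$ and $\bar u=E\bar a$, $\bar v=E\bar b$. Then (i) $\bar u>\bar v$ implies $\bar a\gg\bar b$; in particular $\bar u>\bar 0$ implies $\bar a\gg\bar 0$. (ii) With $\bar 1=[1,\ldots,1]^t$, if $\bar0<\bar u<(p-1)\bar1$ then $\bar0\ll\bar a\ll\bar1$.
   Context: $p$ is prime, $f\ge1$, $q=p^f$. Let $\bar e_0,\ldots,\bar e_{f-1}$ be the standard basis of $\mathbb{R}^f$, with indices taken modulo $f$. $E$ is the $f\times f$ matrix with columns $E_i=p\bar e_{i-1}-\bar e_i$ ($0\le i<f$), so $(E\bar a)_i=pa_{i+1}-a_i$. For vectors, $\bar u\ge\bar v$ means $u_i\ge v_i$ for all $i$; $\bar u>\bar v$ means $\bar u\ge\bar v$ and $u_i>v_i$ for some $i$; $\bar u\gg\bar v$ means $u_i>v_i$ for all $i$. -}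

module Defs where

open import Level using (Level; suc; _⊔_)
open import Data.Nat as ℕ using (ℕ; zero)
open import Data.Nat.DivMod using (_%_; m%n<n)
open import Data.Fin using (Fin; toℕ; fromℕ<)
open import Data.Product using (Σ; ∃; _×_)
open import Data.Sum using (_⊎_)
open import Relation.Nullary using (¬_)
open import Algebra.Bundles using (CommutativeRing)

-- An ordered field: a commutative ring with a strict total order
-- compatible with + and *, in which every nonzero element is invertible.
-- (ℝ is the model relevant to the paper.)
record OrderedField (c ℓ₁ ℓ₂ : Level) : Set (suc (c ⊔ ℓ₁ ⊔ ℓ₂)) where
  field
    commRing : CommutativeRing c ℓ₁
  open CommutativeRing commRing public
  infix 4 _<_
  field
    _<_        : Carrier → Carrier → Set ℓ₂
    <-resp-≈   : ∀ {x x' y y'} → x ≈ x' → y ≈ y' → x < y → x' < y'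
    <-irrefl   : ∀ {x} → ¬ (x < x)
    <-trans    : ∀ {x y z} → x < y → y < z → x < z
    <-trichot  : ∀ x y → x < y ⊎ (x ≈ y ⊎ y < x)
    +-mono-<   : ∀ {x y} z → x < y → x + z < y + z
    *-pos      : ∀ {x y} → 0# < x → 0# < y → 0# < x * y
    0<1        : 0# < 1#
    inverse    : ∀ x → ¬ (x ≈ 0#) → ∃ λ y → x * y ≈ 1#

  infix 4 _≤_
  _≤_ : Carrier → Carrier → Set (ℓ₁ ⊔ ℓ₂)
  x ≤ y = x < y ⊎ x ≈ y

  fromℕ : ℕ → Carrier
  fromℕ zero = 0#
  fromℕ (ℕ.suc n) = 1# + fromℕ n

module VecOrder {c ℓ₁ ℓ₂} (K : OrderedField c ℓ₁ ℓ₂) where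
  open OrderedField K

  -- vectors in K^f, f = suc n ≥ 1, indexed by Fin f (indices mod f)
  Vect : ℕ → Set c
  Vect f = Fin f → Carrier

  next : ∀ {n} → Fin (ℕ.suc n) → Fin (ℕ.suc n)
  next {n} i = fromℕ< (m%n<n (ℕ.suc (toℕ i)) (ℕ.suc n))

  E : ℕ → ∀ {n} → Vect (ℕ.suc n) → Vect (ℕ.suc n)
  E p a i = fromℕ p * a (next i) - a i

  _≥ᵥ_ : ∀ {f} → Vect f → Vect f → Set (ℓ₁ ⊔ ℓ₂)
  u ≥ᵥ v = ∀ i → v i ≤ u i

  _>ᵥ_ : ∀ {f} → Vect f → Vect f → Set (ℓ₁ ⊔ ℓ₂)
  u >ᵥ v = u ≥ᵥ v × ∃ λ i → v i < u i

  _≫_ : ∀ {f} → Vect f → Vect f → Set ℓ₂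
  u ≫ v = ∀ i → v i < u i

  const : ∀ {f} → Carrier → Vect f
  const x _ = x

module Submission where

-- The heart of the proof is a positivity principle: if Eₖ d > 0 then d ≫ 0.
-- Take an index M where d is maximal.  If d_M < 0 then d_{M+1} < 0 too, and
-- d_M ≤ k·d_{M+1} < d_{M+1} ≤ d_M is absurd; so d_M ≥ 0.  Non-negativity
-- propagates along the cycle (dᵢ ≥ 0 ⇒ k·dᵢ₊₁ ≥ 0 ⇒ dᵢ₊₁ ≥ 0), so at the index
-- j where Eₖ d is strictly positive we get k·d_{j+1} > d_j ≥ 0, i.e.
-- d_{j+1} > 0, and positivity propagates around the whole cycle the same way.
--
-- Since Eₖ is affine, the three parts of the lemma
-- are that principle applied to d = a − b, d = a, and d = 1 − a, using
-- Eₖ a − Eₖ b = Eₖ (a − b) and (k − 1) − Eₖ a = Eₖ (1 − a).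

open import Defs
open import Level using (Level)
open import Data.Nat using (ℕ; suc)
open import Data.Nat.Primality using (Prime; prime⇒nonTrivial)
open import Data.Product using (_×_)

open import Data.Nat as ℕ using (zero; s≤s; nonTrivial⇒n>1)
open import Data.Nat.DivMod using (_%_; m<n⇒m%n≡m; n%n≡0)
open import Data.Fin as Fin using (Fin; toℕ; inject₁)
open import Data.Fin.Properties using (toℕ-injective; toℕ-fromℕ<; toℕ-fromℕ; toℕ-inject₁; toℕ<n)
open import Data.Fin.Induction using (<-weakInduction; >-weakInduction)
open import Data.Product using (∃; _,_; proj₁; proj₂)
open import Data.Sum using (inj₁; inj₂)
open import Data.Empty using (⊥-elim)
open import Function using (id)
open import Relation.Binary.PropositionalEquality as ≡ using (_≡_; cong; subst)

module Positivity {c ℓ₁ ℓ₂} (K : OrderedField c ℓ₁ ℓ₂) where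
  open OrderedField K
  open VecOrder K
  open import Algebra.Properties.Ring ring using (x[y-z]≈xy-xz; [y-z]x≈yx-zx; -‿+-comm)
  open import Algebra.Properties.CommutativeSemigroup +-commutativeSemigroup using (interchange)

  module _ {n : ℕ} where

    next-inject₁ : (i : Fin n) → next (inject₁ i) ≡ Fin.suc i
    next-inject₁ i = toℕ-injective (begin
      toℕ (next (inject₁ i))   ≡⟨ toℕ-fromℕ< _ ⟩
      suc (toℕ (inject₁ i)) % suc n ≡⟨ cong (λ m → suc m % suc n) (toℕ-inject₁ i) ⟩
      suc (toℕ i) % suc n      ≡⟨ m<n⇒m%n≡m (s≤s (toℕ<n i)) ⟩
      suc (toℕ i)              ∎)
      where open ≡.≡-Reasoning

    next-last : next (Fin.fromℕ n) ≡ Fin.zero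
    next-last = toℕ-injective (begin
      toℕ (next (Fin.fromℕ n))      ≡⟨ toℕ-fromℕ< _ ⟩
      suc (toℕ (Fin.fromℕ n)) % suc n ≡⟨ cong (λ m → suc m % suc n) (toℕ-fromℕ n) ⟩
      suc n % suc n               ≡⟨ n%n≡0 (suc n) ⟩
      0                           ∎)
      where open ≡.≡-Reasoning

    -- A property preserved by i ↦ next i and true somewhere is true everywhere:
    -- walk up from j to the last index, wrap around to 0, and walk up to i.
    cyclic-induction : ∀ {ℓ} (Q : Fin (suc n) → Set ℓ) → (∀ i → Q i → Q (next i)) →
                       ∀ j → Q j → ∀ i → Q i
    cyclic-induction Q step j Qj = <-weakInduction Q Q-zero step-up
      where
      step-up : ∀ i → Q (inject₁ i) → Q (Fin.suc i)
      step-up i q = subst Q (next-inject₁ i) (step (inject₁ i) q)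

      reaches-last : ∀ i → Q i → Q (Fin.fromℕ n)
      reaches-last = >-weakInduction (λ i → Q i → Q (Fin.fromℕ n)) id
                       (λ i onward q → onward (step-up i q))

      Q-zero : Q Fin.zero
      Q-zero = subst Q next-last (step (Fin.fromℕ n) (reaches-last j Qj))

  <-≤-trans : ∀ {x y z} → x < y → y ≤ z → x < z
  <-≤-trans x<y (inj₁ y<z) = <-trans x<y y<z
  <-≤-trans x<y (inj₂ y≈z) = <-resp-≈ refl y≈z x<y

  ≤-<-trans : ∀ {x y z} → x ≤ y → y < z → x < z
  ≤-<-trans (inj₁ x<y) y<z = <-trans x<y y<z
  ≤-<-trans (inj₂ x≈y) y<z = <-resp-≈ (sym x≈y) refl y<z

  ≤-trans : ∀ {x y z} → x ≤ y → y ≤ z → x ≤ z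
  ≤-trans (inj₁ x<y) y≤z = inj₁ (<-≤-trans x<y y≤z)
  ≤-trans (inj₂ x≈y) (inj₁ y<z) = inj₁ (<-resp-≈ (sym x≈y) refl y<z)
  ≤-trans (inj₂ x≈y) (inj₂ y≈z) = inj₂ (trans x≈y y≈z)

  ≤-resp-≈ : ∀ {x x' y y'} → x ≈ x' → y ≈ y' → x ≤ y → x' ≤ y'
  ≤-resp-≈ x≈x' y≈y' (inj₁ x<y) = inj₁ (<-resp-≈ x≈x' y≈y' x<y)
  ≤-resp-≈ x≈x' y≈y' (inj₂ x≈y) = inj₂ (trans (sym x≈x') (trans x≈y y≈y'))

  sub-cancel : ∀ y x → (y - x) + x ≈ y
  sub-cancel y x = trans (+-assoc y (- x) x) (trans (+-congˡ (-‿inverseˡ x)) (+-identityʳ y))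

  <⇒sub-pos : ∀ {x y} → x < y → 0# < y - x
  <⇒sub-pos {x} x<y = <-resp-≈ (-‿inverseʳ x) refl (+-mono-< (- x) x<y)

  sub-pos⇒< : ∀ {x y} → 0# < y - x → x < y
  sub-pos⇒< {x} {y} h = <-resp-≈ (+-identityˡ x) (sub-cancel y x) (+-mono-< x h)

  sub-neg⇒< : ∀ {x y} → x - y < 0# → x < y
  sub-neg⇒< {x} {y} h = <-resp-≈ (sub-cancel x y) (+-identityˡ y) (+-mono-< y h)

  ≤⇒sub-nonneg : ∀ {x y} → x ≤ y → 0# ≤ y - x
  ≤⇒sub-nonneg (inj₁ x<y) = inj₁ (<⇒sub-pos x<y)
  ≤⇒sub-nonneg {x} (inj₂ x≈y) = inj₂ (trans (sym (-‿inverseʳ x)) (+-congʳ x≈y))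

  sub-nonneg⇒≤ : ∀ {x y} → 0# ≤ y - x → x ≤ y
  sub-nonneg⇒≤ (inj₁ h) = inj₁ (sub-pos⇒< h)
  sub-nonneg⇒≤ {x} {y} (inj₂ e) = inj₂ (trans (sym (+-identityˡ x)) (trans (+-congʳ e) (sub-cancel y x)))

  *-neg : ∀ {k x} → 0# < k → x < 0# → k * x < 0#
  *-neg {k} {x} 0<k x<0 = sub-pos⇒< (<-resp-≈ refl k[0-x]≈0-kx (*-pos 0<k (<⇒sub-pos x<0)))
    where
    k[0-x]≈0-kx : k * (0# - x) ≈ 0# - k * x
    k[0-x]≈0-kx = trans (x[y-z]≈xy-xz k 0# x) (+-congʳ (zeroʳ k))

  pos-of-*-pos : ∀ {k x} → 0# < k → 0# < k * x → 0# < x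
  pos-of-*-pos {k} {x} 0<k 0<kx with <-trichot x 0#
  ... | inj₁ x<0 = ⊥-elim (<-irrefl (<-trans 0<kx (*-neg 0<k x<0)))
  ... | inj₂ (inj₁ x≈0) = ⊥-elim (<-irrefl (<-resp-≈ refl (trans (*-congˡ x≈0) (zeroʳ k)) 0<kx))
  ... | inj₂ (inj₂ 0<x) = 0<x

  nonneg-of-*-nonneg : ∀ {k x} → 0# < k → 0# ≤ k * x → 0# ≤ x
  nonneg-of-*-nonneg {k} {x} 0<k 0≤kx with <-trichot x 0#
  ... | inj₁ x<0 = ⊥-elim (<-irrefl (≤-<-trans 0≤kx (*-neg 0<k x<0)))
  ... | inj₂ (inj₁ x≈0) = inj₂ (sym x≈0)
  ... | inj₂ (inj₂ 0<x) = inj₁ 0<x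

  >1-shrinks-neg : ∀ {k d} → 1# < k → d < 0# → k * d < d
  >1-shrinks-neg {k} {d} 1<k d<0 =
    sub-neg⇒< (<-resp-≈ [k-1]d≈kd-d refl (*-neg (<⇒sub-pos 1<k) d<0))
    where
    [k-1]d≈kd-d : (k - 1#) * d ≈ k * d - d
    [k-1]d≈kd-d = trans ([y-z]x≈yx-zx d k 1#) (+-congˡ (-‿cong (*-identityˡ d)))

  argmax : ∀ {m} (d : Vect (suc m)) → ∃ λ M → ∀ j → d j ≤ d M
  argmax {zero} d = Fin.zero , λ { Fin.zero → inj₂ refl }
  argmax {suc m} d with argmax (λ j → d (Fin.suc j))
  ... | M , d≤dM with <-trichot (d Fin.zero) (d (Fin.suc M))
  ...   | inj₁ d0<dM = Fin.suc M , λ { Fin.zero → inj₁ d0<dM ; (Fin.suc j) → d≤dM j }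
  ...   | inj₂ (inj₁ d0≈dM) = Fin.suc M , λ { Fin.zero → inj₂ d0≈dM ; (Fin.suc j) → d≤dM j }
  ...   | inj₂ (inj₂ dM<d0) = Fin.zero ,
            λ { Fin.zero → inj₂ refl ; (Fin.suc j) → inj₁ (≤-<-trans (d≤dM j) dM<d0) }

  Eₖ : Carrier → ∀ {n} → Vect (suc n) → Vect (suc n)
  Eₖ k d i = k * d (next i) - d i

  Eₖ-pos⇒pos : ∀ {n} {k} → 1# < k → (d : Vect (suc n)) →
               Eₖ k d >ᵥ const 0# → d ≫ const 0#
  Eₖ-pos⇒pos {n} {k} 1<k d (Ed≥0 , j , Edj>0) =
    cyclic-induction (λ i → 0# < d i) positive-step (next j) positive-after-j
    where
    0<k : 0# < k
    0<k = <-trans 0<1 1<k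

    d≤kd' : ∀ i → d i ≤ k * d (next i)
    d≤kd' i = sub-nonneg⇒≤ (Ed≥0 i)

    positive-step : ∀ i → 0# < d i → 0# < d (next i)
    positive-step i 0<di = pos-of-*-pos 0<k (<-≤-trans 0<di (d≤kd' i))

    nonneg-step : ∀ i → 0# ≤ d i → 0# ≤ d (next i)
    nonneg-step i 0≤di = nonneg-of-*-nonneg 0<k (≤-trans 0≤di (d≤kd' i))

    M : Fin (suc n)
    M = proj₁ (argmax d)

    max-nonneg : 0# ≤ d M
    max-nonneg with <-trichot (d M) 0#
    ... | inj₁ dM<0 = ⊥-elim (<-irrefl (≤-<-trans (d≤kd' M) (<-≤-trans kd'<d' d'≤dM)))
      where
      d'≤dM : d (next M) ≤ d M
      d'≤dM = proj₂ (argmax d) (next M)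
      kd'<d' : k * d (next M) < d (next M)
      kd'<d' = >1-shrinks-neg 1<k (≤-<-trans d'≤dM dM<0)
    ... | inj₂ (inj₁ dM≈0) = inj₂ (sym dM≈0)
    ... | inj₂ (inj₂ 0<dM) = inj₁ 0<dM

    positive-after-j : 0# < d (next j)
    positive-after-j = pos-of-*-pos 0<k
      (≤-<-trans (cyclic-induction (λ i → 0# ≤ d i) nonneg-step M max-nonneg j)
                 (sub-pos⇒< Edj>0))

  >ᵥ⇒diff-pos : ∀ {f} {u v w : Vect f} → u >ᵥ v → (∀ i → u i - v i ≈ w i) → w >ᵥ const 0#
  >ᵥ⇒diff-pos (u≥v , j , vj<uj) u-v≈w =
    (λ i → ≤-resp-≈ refl (u-v≈w i) (≤⇒sub-nonneg (u≥v i))) ,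
    j , <-resp-≈ refl (u-v≈w j) (<⇒sub-pos vj<uj)

  sub-interchange : ∀ a b x y → (a - b) - (x - y) ≈ (a - x) - (b - y)
  sub-interchange a b x y = trans (+-congˡ (sym (-‿+-comm x (- y))))
    (trans (interchange a (- b) (- x) (- (- y))) (+-congˡ (-‿+-comm b (- y))))

  Eₖ-sub : ∀ {n} k (a b : Vect (suc n)) i →
           Eₖ k a i - Eₖ k b i ≈ Eₖ k (λ i → a i - b i) i
  Eₖ-sub k a b i = trans (sub-interchange (k * a (next i)) (a i) (k * b (next i)) (b i))
    (+-congʳ (sym (x[y-z]≈xy-xz k (a (next i)) (b (next i)))))

  Eₖ-complement : ∀ {n} k (a : Vect (suc n)) i →
                  (k - 1#) - Eₖ k a i ≈ Eₖ k (λ i → 1# - a i) i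
  Eₖ-complement k a i = trans (sub-interchange k 1# (k * a (next i)) (a i))
    (+-congʳ (trans (+-congʳ (sym (*-identityʳ k))) (sym (x[y-z]≈xy-xz k 1# (a (next i))))))

  1<1+pos : ∀ {x} → 0# < x → 1# < 1# + x
  1<1+pos {x} 0<x = <-resp-≈ (+-identityˡ 1#) (+-comm x 1#) (+-mono-< 1# 0<x)

  fromℕ-pos : ∀ m → 0# < fromℕ (suc m)
  fromℕ-pos zero = <-resp-≈ refl (sym (+-identityʳ 1#)) 0<1
  fromℕ-pos (suc m) = <-trans 0<1 (1<1+pos (fromℕ-pos m))

  1<fromℕ : ∀ p → 1 ℕ.< p → 1# < fromℕ p
  1<fromℕ (suc zero) (s≤s ())
  1<fromℕ (suc (suc m)) _ = 1<1+pos (fromℕ-pos m)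

lemma3p8 : ∀ {c ℓ₁ ℓ₂ : Level} (K : OrderedField c ℓ₁ ℓ₂) →
    let open OrderedField K in let open VecOrder K in
    (p : ℕ) → Prime p → (n : ℕ) → (a b : Vect (suc n)) →
    ((E p a >ᵥ E p b) → (a ≫ b))
    × ((E p a >ᵥ const 0#) → (a ≫ const 0#))
    × ((E p a >ᵥ const 0#) → (const (fromℕ p - 1#) >ᵥ E p a)
    → ((a ≫ const 0#) × (const 1# ≫ a)))
lemma3p8 K p p-prime n a b = part-i , part-i₀ , part-ii
  where
  open OrderedField K
  open VecOrder K
  open Positivity K

  1<p : 1# < fromℕ p
  1<p = 1<fromℕ p (nonTrivial⇒n>1 p {{prime⇒nonTrivial p-prime}})

  part-i : E p a >ᵥ E p b → a ≫ b
  part-i Ea>Eb i = sub-pos⇒< (Eₖ-pos⇒pos 1<p _ (>ᵥ⇒diff-pos Ea>Eb (Eₖ-sub _ a b)) i)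

  part-i₀ : E p a >ᵥ const 0# → a ≫ const 0#
  part-i₀ = Eₖ-pos⇒pos 1<p a

  part-ii : E p a >ᵥ const 0# → const (fromℕ p - 1#) >ᵥ E p a
          → (a ≫ const 0#) × (const 1# ≫ a)
  part-ii Ea>0 p-1>Ea = part-i₀ Ea>0 ,
    λ i → sub-pos⇒< (Eₖ-pos⇒pos 1<p _ (>ᵥ⇒diff-pos p-1>Ea (Eₖ-complement _ a)) i)
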